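{- Every class $\mathcal C$ of graphs with $\sup_{G\in\mathcal C}\mathrm{smw}_1(G)<\infty$ admits an adjacency labelling scheme of length $O(\log n)$.
   Context: Graphs are finite, simple, undirected. For a partition $\mathcal P$ of $V(G)$ and $X\subseteq V(G)$, $X/\mathcal P$ is the set of parts of $\mathcal P$ intersecting $X$. For $R\subseteq\binom{V(G)}2$, $\mathrm{Ball}^r_R(v)$ is the radius-$r$ ball around $v$ in $(V(G),R)$. $\mathcal P$ is homogeneous modulo $R$ if for all parts $X,Y$ (possibly equal), the pairs $\{x,y\}$, $x\in X,y\in Y$, $x\ne y$, not in $R$ are all edges or all non-edges of $G$. A merge sequence for $G$ is $(\mathcal P_1,R_1),\dots,(\mathcal P_m,R_m)$ with $\mathcal P_1\preceq\dots\preceq\mathcal P_m$ partitions of $V(G)$, $\mathcal P_1$ into singletons, $\mathcal P_m=\{V(G)\}$, $R_1\subseteq\dots\subseteq R_m$, $\mathcal P_t$ homogeneous modulo $R_t$; $m$ is its length; its radius-$r$ width is $\max_{t<m}\max_v|\mathrm{Ball}^r_{R_{t+1}}(v)/\mathcal P_t|$; its valency is the least $\Delta$ such that for every $i\in[m-1]$ each part of $\mathcal P_{i+1}$ is a union of at most $\Delta$ parts of $\mathcal P_i$. The radius-$r$ short merge-width $\mathrm{smw}_r(G)$ is the least $k$ such that $G$ has a merge sequence of radius-$r$ width at most $k$, valency at most $k$, and length at most $k\log_2|V(G)|+k$. A labelling scheme for $\mathcal C$ is a pair of functions: an encoder assigning to each $G\in\mathcal C$ and $u\in V(G)$ a binary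 word $\mathcal E_G(u)$, and a decoder mapping pairs of binary words to accept/reject, such that for every $G\in\mathcal C$ and distinct $u,v\in V(G)$, $uv\in E(G)$ iff the decoder accepts $(\mathcal E_G(u),\mathcal E_G(v))$. Its length is $\ell(n)=\max\{|\mathcal E_G(u)|: G\in\mathcal C, |V(G)|=n, u\in V(G)\}$; no computability requirements are imposed. -}

module Defs where

open import Data.Nat using (ℕ; zero; suc; _+_; _*_; _∸_; _^_; _≤_; _<_)
open import Data.Nat.Properties using (_≟_)
open import Data.Nat.Logarithm using (⌈log₂_⌉)
open import Data.Bool using (Bool; true; false; _∧_; _∨_)
open import Data.Fin using (Fin)
import Data.Fin.Properties as FinP
open import Data.List using (List; length; map; filter; deduplicate)
open import Data.Bool.ListAction using (any)
open import Data.List.Base using (allFin)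
open import Data.Product using (Σ; ∃; ∃-syntax; _×_; _,_)
open import Data.Sum using (_⊎_)
open import Relation.Nullary using (¬_; does)
open import Relation.Binary.PropositionalEquality using (_≡_; _≢_)

record Graph (n : ℕ) : Set where
  field
    adj     : Fin n → Fin n → Bool
    adj-sym : ∀ x y → adj x y ≡ adj y x
    irrefl  : ∀ x → adj x x ≡ false
open Graph public

-- A partition of Fin n is represented by a labelling Fin n → ℕ;
-- its parts are the (non-empty) fibres.
Partition : ℕ → Set
Partition n = Fin n → ℕ

-- A set of unordered pairs of vertices: a symmetric Bool-valued relation
-- (the diagonal is irrelevant).
PairSet : ℕ → Set
PairSet n = Fin n → Fin n → Bool

_==F_ : ∀ {n} → Fin n → Fin n → Bool
x ==F y = does (x FinP.≟ y)

inBall : ∀ {n} → PairSet n → ℕ → Fin n → Fin n → Bool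
inBall R zero    v u = v ==F u
inBall {n} R (suc r) v u =
  inBall R r v u ∨ any (λ w → inBall R r v w ∧ R w u) (allFin n)

#partsMeeting : ∀ {n} → Partition n → (Fin n → Bool) → ℕ
#partsMeeting {n} P S =
  length (deduplicate _≟_ (map P (filter (λ u → S u Data.Bool.≟ true) (allFin n))))
  where import Data.Bool

-- length condition  m ≤ k·log₂ n + k  (for n ≥ 1), stated in integers:
-- either m ≤ k, or 2^(m-k) ≤ n^k.
LengthOK : ℕ → ℕ → ℕ → Set
LengthOK k m n = m ≤ k ⊎ 2 ^ (m ∸ k) ≤ n ^ k

-- A merge sequence (P_1,R_1),...,(P_m,R_m) of G, stored 0-indexed:
-- P t, R t for t < m correspond to P_{t+1}, R_{t+1}.
record MergeSeq {n : ℕ} (G : Graph n) (m : ℕ) : Set where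
  field
    P : ℕ → Partition n
    R : ℕ → PairSet n
    R-sym      : ∀ t x y → R t x y ≡ R t y x
    m-pos      : 1 ≤ m
    refines    : ∀ t → suc t < m → ∀ x y → P t x ≡ P t y → P (suc t) x ≡ P (suc t) y
    R-mono     : ∀ t → suc t < m → ∀ x y → R t x y ≡ true → R (suc t) x y ≡ true
    first-sing : ∀ x y → P 0 x ≡ P 0 y → x ≡ y
    last-whole : ∀ x y → P (m ∸ 1) x ≡ P (m ∸ 1) y
    homogeneous : ∀ t → t < m → ∀ x y x′ y′ → x ≢ y → x′ ≢ y′ →
      P t x ≡ P t x′ → P t y ≡ P t y′ →
      R t x y ≡ false → R t x′ y′ ≡ false →
      adj G x y ≡ adj G x′ y′
open MergeSeq public

WidthAtMost : ∀ {n} {G : Graph n} {m} → ℕ → ℕ → MergeSeq G m → Set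
WidthAtMost {n} {G} {m} r k S =
  ∀ t → suc t < m → ∀ (v : Fin n) →
    #partsMeeting (P S t) (inBall (R S (suc t)) r v) ≤ k

ValencyAtMost : ∀ {n} {G : Graph n} {m} → ℕ → MergeSeq G m → Set
ValencyAtMost {n} {G} {m} k S =
  ∀ t → suc t < m → ∀ (x : Fin n) →
    #partsMeeting (P S t) (λ y → does (P S (suc t) y ≟ P S (suc t) x)) ≤ k

SMW≤ : ∀ {n} → ℕ → Graph n → ℕ → Set
SMW≤ {n} r G k = Σ ℕ λ m → Σ (MergeSeq G m) λ S →
  WidthAtMost r k S × ValencyAtMost k S × LengthOK k m n

GraphClass : Set₁
GraphClass = (n : ℕ) → Graph n → Set

HasLogLabelling : GraphClass → Set
HasLogLabelling C =
  Σ ((n : ℕ) → Graph n → Fin n → List Bool) λ enc →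
  Σ (List Bool → List Bool → Bool) λ dec →
    (∀ n G → C n G → ∀ u v → u ≢ v → adj G u v ≡ dec (enc n G u) (enc n G v))
    × (∃[ c ] ∀ n G → C n G → ∀ u → length (enc n G u) ≤ c * ⌈log₂ n ⌉ + c)

-- Fix a merge sequence (P_t, R_t), t < m, of radius-1 width and valency at most k, with
-- m = O(k log n).  A part of P_t is named by its address: the positions (each at most k) of
-- it and of its ancestors among the parts merged into their parents.  The label of u has
-- one block per level t, holding u's own position and one entry for each of the at most k
-- parts of P_t meeting the R_{t+1}-ball of radius 1 around u: a pointer to the entry of its
-- parent in the block above, its position, and the adjacency between u and that part, which
-- is well defined on pairs outside R_t by homogeneity.  Reading u's blocks from the top, the
-- decoder rebuilds the addresses of the entries and compares them with the address of v,
-- read off v's label.  At the lowest level where v's part appears the answer is right: either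
-- the level is 0, where parts are singletons, or v was not near u one level below, so uv is
-- outside R_t.  A block takes O(k²) bits, so labels have O(log n) bits.  The encoder cannot
-- see the merge sequence, so it searches all labellings of that length for a correct one.

module Submission where

open import Defs

open import Data.Bool using (Bool; true; false; T; _∧_)
import Data.Bool as Bool
open import Data.Bool.ListAction using (any)
open import Data.Bool.Properties using (T-≡; ¬-not)
open import Data.Empty using (⊥-elim)
open import Data.Fin using (Fin)
import Data.Fin.Properties as Fin
open import Data.List
  using (List; []; _∷_; [_]; _++_; map; concatMap; length; filter; deduplicate; downFrom; cartesianProductWith)
open import Data.List.Base using (allFin)
open import Data.List.Properties
  using (≡-dec; ++-identityʳ; length-++; length-map; length-downFrom; map-∘; map-cong-local; ∷-injectiveˡ; ∷-injectiveʳ)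
open import Data.List.Membership.Propositional using (_∈_; find; lose)
open import Data.List.Membership.Propositional.Properties
  using (∈-allFin; ∈-map⁺; ∈-filter⁺; ∈-filter⁻; ∈-deduplicate⁺; ∈-cartesianProductWith⁺)
open import Data.List.Relation.Unary.All as All using (All; []; _∷_)
import Data.List.Relation.Unary.All.Properties as All
open import Data.List.Relation.Unary.Any as Any using (Any; here; there; satisfied)
import Data.List.Relation.Unary.Any.Properties as Anyₚ
open import Data.Maybe using (Maybe; just; nothing; fromMaybe)
open import Data.Maybe.Properties using (just-injective)
open import Data.Nat using (ℕ; zero; suc; _+_; _*_; _∸_; _^_; _≤_; _<_; z≤n; s≤s; _≤?_; _<?_; ⌈_/2⌉)
open import Data.Nat.Induction using (<-wellFounded)
open import Data.Nat.Logarithm using (⌈log₂_⌉; ⌈log₂⌉-mono-≤; ⌈log₂2^n⌉≡n)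
open import Data.Nat.Logarithm.Core using (⌈log2⌉)
open import Data.Nat.Properties
open import Data.Nat.Solver using (module +-*-Solver)
open import Data.Product using (∃; ∃-syntax; _×_; _,_; proj₁; proj₂; map₁)
open import Data.Sum using (_⊎_; inj₁; inj₂; map₂)
open import Data.Unit using (⊤; tt)
open import Data.Vec as Vec using (Vec; []; _∷_; lookup; tabulate)
open import Data.Vec.Properties using (lookup∘tabulate)
open import Function using (id; _∘_; case_of_; Equivalence)
open import Induction.WellFounded using (Acc; acc)
open import Relation.Binary.PropositionalEquality
  using (_≡_; _≢_; refl; sym; trans; cong; cong₂; subst; subst₂; module ≡-Reasoning)
open import Relation.Nullary using (yes; no; does; ¬_; ¬?)
open import Relation.Nullary.Decidable using (dec-true; dec-false; _×-dec_; _⊎-dec_; _→-dec_)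
open import Relation.Unary using (Decidable)

open +-*-Solver using (solve; _:+_; _:*_; _:=_)

n≤2^⌈log₂n⌉ : ∀ n → n ≤ 2 ^ ⌈log₂ n ⌉
n≤2^⌈log₂n⌉ n = bound n (<-wellFounded n)
  where
  bound : ∀ n (rec : Acc _<_ n) → n ≤ 2 ^ ⌈log2⌉ n rec
  bound 0 _ = z≤n
  bound 1 _ = s≤s z≤n
  bound (suc (suc n)) (acc rs) = begin
    suc (suc n)        ≤⟨ s≤s (s≤s n≤h+h) ⟩
    suc (suc (h + h))  ≡⟨ cong suc (sym (+-suc h h)) ⟩
    suc h + suc h      ≤⟨ +-mono-≤ ih ih ⟩
    p + p              ≡⟨ cong (p +_) (sym (+-identityʳ p)) ⟩
    2 * p              ∎
    where
    open ≤-Reasoning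
    h = ⌈ n /2⌉
    ih = bound (suc h) (rs (⌈n/2⌉<n n))
    p = 2 ^ ⌈log2⌉ (suc h) (rs (⌈n/2⌉<n n))
    n≤h+h : n ≤ h + h
    n≤h+h = subst (_≤ h + h) (⌊n/2⌋+⌈n/2⌉≡n n) (+-monoˡ-≤ h (⌊n/2⌋≤⌈n/2⌉ n))

LengthOK⇒≤ : ∀ {k m n} → LengthOK k m n → m ≤ k + k * ⌈log₂ n ⌉
LengthOK⇒≤ {k} (inj₁ m≤k) = ≤-trans m≤k (m≤m+n k _)
LengthOK⇒≤ {k} {m} {n} (inj₂ 2^[m∸k]≤n^k) = begin
  m             ≤⟨ m≤n+m∸n m k ⟩
  k + (m ∸ k)   ≤⟨ +-monoʳ-≤ k m∸k≤L*k ⟩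
  k + L * k     ≡⟨ cong (k +_) (*-comm L k) ⟩
  k + k * L     ∎
  where
  open ≤-Reasoning
  L = ⌈log₂ n ⌉

  2^[m∸k]≤2^[L*k] : 2 ^ (m ∸ k) ≤ 2 ^ (L * k)
  2^[m∸k]≤2^[L*k] = begin
    2 ^ (m ∸ k)    ≤⟨ 2^[m∸k]≤n^k ⟩
    n ^ k          ≤⟨ ^-monoˡ-≤ k (n≤2^⌈log₂n⌉ n) ⟩
    (2 ^ L) ^ k    ≡⟨ ^-*-assoc 2 L k ⟩
    2 ^ (L * k)    ∎

  m∸k≤L*k : m ∸ k ≤ L * k
  m∸k≤L*k = subst₂ _≤_ (⌈log₂2^n⌉≡n (m ∸ k)) (⌈log₂2^n⌉≡n (L * k)) (⌈log₂⌉-mono-≤ 2^[m∸k]≤2^[L*k])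

m>n⇒m∸n≡1+[m∸1+n] : ∀ {m n} → n < m → m ∸ n ≡ suc (m ∸ suc n)
m>n⇒m∸n≡1+[m∸1+n] {suc m} {zero}  _         = refl
m>n⇒m∸n≡1+[m∸1+n] {suc m} {suc n} (s≤s n<m) = m>n⇒m∸n≡1+[m∸1+n] n<m

module _ {A B : Set} (f : A → B) where

  map-filter : ∀ {P : B → Set} (P? : Decidable P) xs →
               map f (filter (P? ∘ f) xs) ≡ filter P? (map f xs)
  map-filter P? [] = refl
  map-filter P? (x ∷ xs) with does (P? (f x))
  ... | true  = cong (f x ∷_) (map-filter P? xs)
  ... | false = map-filter P? xs

lookupOr : {A : Set} → List A → ℕ → A → A
lookupOr []       _       d = d
lookupOr (x ∷ xs) zero    d = x
lookupOr (x ∷ xs) (suc i) d = lookupOr xs i d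

module _ {A : Set} (f : A → ℕ) where

  deduplicateOn : List A → List A
  deduplicateOn = deduplicate (λ x y → f x ≟ f y)

  map-deduplicateOn : ∀ xs → map f (deduplicateOn xs) ≡ deduplicate _≟_ (map f xs)
  map-deduplicateOn [] = refl
  map-deduplicateOn (x ∷ xs) = cong (f x ∷_) (begin
    map f (filter (¬? ∘ (f x ≟_) ∘ f) (deduplicateOn xs))  ≡⟨ map-filter f (¬? ∘ (f x ≟_)) (deduplicateOn xs) ⟩
    filter (¬? ∘ (f x ≟_)) (map f (deduplicateOn xs))      ≡⟨ cong (filter (¬? ∘ (f x ≟_))) (map-deduplicateOn xs) ⟩
    filter (¬? ∘ (f x ≟_)) (deduplicate _≟_ (map f xs))    ∎)
    where open ≡-Reasoning

  ∈-deduplicateOn⁻ : ∀ xs {z} → z ∈ deduplicateOn xs → z ∈ xs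
  ∈-deduplicateOn⁻ xs = Anyₚ.deduplicate⁻ _

  deduplicateOn-complete : ∀ {x xs} → x ∈ xs → ∃ λ z → z ∈ deduplicateOn xs × f z ≡ f x
  deduplicateOn-complete x∈xs =
    find (Anyₚ.deduplicate⁺ _ (λ fb≡fa fa≡fx → trans fb≡fa fa≡fx) (Any.map (λ x≡y → cong f (sym x≡y)) x∈xs))

  firstIndexOn : ℕ → List A → ℕ
  firstIndexOn a [] = 0
  firstIndexOn a (z ∷ zs) with f z ≟ a
  ... | yes _ = 0
  ... | no  _ = suc (firstIndexOn a zs)

  firstIndexOn-≤ : ∀ a zs → firstIndexOn a zs ≤ length zs
  firstIndexOn-≤ a [] = z≤n
  firstIndexOn-≤ a (z ∷ zs) with f z ≟ a
  ... | yes _ = z≤n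
  ... | no  _ = s≤s (firstIndexOn-≤ a zs)

  lookupOr-firstIndexOn : ∀ {B : Set} (g : A → B) d {a x} zs → x ∈ zs → f x ≡ a →
    ∃ λ z → z ∈ zs × f z ≡ a × lookupOr (map g zs) (firstIndexOn a zs) d ≡ g z
  lookupOr-firstIndexOn g d {a} (z ∷ zs) x∈ fx≡a with f z ≟ a
  ... | yes fz≡a = z , here refl , fz≡a , refl
  ... | no  fz≢a with x∈
  ...   | here refl = ⊥-elim (fz≢a fx≡a)
  ...   | there x∈zs =
    let z′ , z′∈zs , fz′≡a , lookup≡ = lookupOr-firstIndexOn g d zs x∈zs fx≡a
    in z′ , there z′∈zs , fz′≡a , lookup≡

  firstIndexOn-injective : ∀ {x y} zs → x ∈ zs → y ∈ zs →
    firstIndexOn (f x) zs ≡ firstIndexOn (f y) zs → f x ≡ f y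
  firstIndexOn-injective {x} {y} zs x∈zs y∈zs same-index
    with zx , _ , fzx≡fx , lookup≡fzx ← lookupOr-firstIndexOn f 0 zs x∈zs refl
       | zy , _ , fzy≡fy , lookup≡fzy ← lookupOr-firstIndexOn f 0 zs y∈zs refl = begin
    f x                                      ≡⟨ sym fzx≡fx ⟩
    f zx                                     ≡⟨ sym lookup≡fzx ⟩
    lookupOr (map f zs) (firstIndexOn (f x) zs) 0  ≡⟨ cong (λ i → lookupOr (map f zs) i 0) same-index ⟩
    lookupOr (map f zs) (firstIndexOn (f y) zs) 0  ≡⟨ lookup≡fzy ⟩
    f zy                                     ≡⟨ fzy≡fy ⟩
    f y                                      ∎
    where open ≡-Reasoning

length-concatMap-≤ : ∀ {A B : Set} (f : A → List B) {c xs} →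
  All (λ x → length (f x) ≤ c) xs → length (concatMap f xs) ≤ length xs * c
length-concatMap-≤ f [] = z≤n
length-concatMap-≤ f {c} {x ∷ xs} (fx≤c ∷ rest) = begin
  length (f x ++ concatMap f xs)        ≡⟨ length-++ (f x) ⟩
  length (f x) + length (concatMap f xs) ≤⟨ +-mono-≤ fx≤c (length-concatMap-≤ f rest) ⟩
  c + length xs * c                      ∎
  where open ≤-Reasoning

members : ∀ {n} → (Fin n → Bool) → List (Fin n)
members {n} S = filter (λ u → S u Bool.≟ true) (allFin n)

partsMeeting : ∀ {n} → Partition n → (Fin n → Bool) → List ℕ
partsMeeting P S = deduplicate _≟_ (map P (members S))

∈-members⁺ : ∀ {n} {S : Fin n → Bool} {x} → S x ≡ true → x ∈ members S
∈-members⁺ Sx = ∈-filter⁺ _ (∈-allFin _) Sx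

∈-members⁻ : ∀ {n} (S : Fin n → Bool) {x} → x ∈ members S → S x ≡ true
∈-members⁻ {n} S x∈ = proj₂ (∈-filter⁻ (λ u → S u Bool.≟ true) {xs = allFin n} x∈)

∈-partsMeeting : ∀ {n} (P : Partition n) {S x} → S x ≡ true → P x ∈ partsMeeting P S
∈-partsMeeting P Sx = ∈-deduplicate⁺ _≟_ (∈-map⁺ P (∈-members⁺ Sx))

-- Balls of radius one

inBall₁⁻ : ∀ {n} (R : PairSet n) {u x} → inBall R 1 u x ≡ true → u ≡ x ⊎ R u x ≡ true
inBall₁⁻ {n} R {u} {x} ball with u Fin.≟ x
... | yes u≡x = inj₁ u≡x
... | no _ with w , _ , viaW ← find (Anyₚ.any⁻ _ (allFin n) (Equivalence.from T-≡ ball)) with u Fin.≟ w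
...   | yes refl = inj₂ (Equivalence.to T-≡ viaW)
...   | no _     = ⊥-elim viaW

inBall₁⁺ : ∀ {n} (R : PairSet n) {u x} → u ≡ x ⊎ R u x ≡ true → inBall R 1 u x ≡ true
inBall₁⁺ R {u} (inj₁ refl) rewrite dec-true (u Fin.≟ u) refl = refl
inBall₁⁺ R {u} {x} (inj₂ Rux) with u Fin.≟ x
... | yes _ = refl
... | no  _ = Equivalence.to T-≡ (Anyₚ.any⁺ _ (lose (∈-allFin u) u-witnesses))
  where
  u-witnesses : T ((u ==F u) ∧ R u x)
  u-witnesses rewrite dec-true (u Fin.≟ u) refl = Equivalence.from T-≡ Rux

-- Labels as bit strings

Entry : Set
Entry = ℕ × ℕ × Bool

Block : Set
Block = ℕ × List Entry

unaryDigit : ℕ → List Bool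
unaryDigit zero    = [ false ]
unaryDigit (suc j) = true ∷ unaryDigit j

unary : List ℕ → List Bool
unary = concatMap unaryDigit

ununary : List Bool → List ℕ
ununary []           = []
ununary (false ∷ bs) = 0 ∷ ununary bs
ununary (true  ∷ bs) = incrementHead (ununary bs)
  where
  incrementHead : List ℕ → List ℕ
  incrementHead []       = [ 1 ]
  incrementHead (j ∷ js) = suc j ∷ js

ununary-unaryDigit : ∀ j bs → ununary (unaryDigit j ++ bs) ≡ j ∷ ununary bs
ununary-unaryDigit zero    bs = refl
ununary-unaryDigit (suc j) bs rewrite ununary-unaryDigit j bs = refl

ununary-unary : ∀ js → ununary (unary js) ≡ js
ununary-unary []       = refl
ununary-unary (j ∷ js) rewrite ununary-unaryDigit j (unary js) | ununary-unary js = refl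

length-unaryDigit : ∀ j → length (unaryDigit j) ≡ suc j
length-unaryDigit zero    = refl
length-unaryDigit (suc j) = cong suc (length-unaryDigit j)

length-unary-≤ : ∀ {B js} → All (_≤ B) js → length (unary js) ≤ length js * suc B
length-unary-≤ js≤B = length-concatMap-≤ unaryDigit
  (All.map (λ {j} j≤B → ≤-trans (≤-reflexive (length-unaryDigit j)) (s≤s j≤B)) js≤B)

-- The tag of an entry also carries its bit.
entryCode : Entry → List ℕ
entryCode (i , c , false) = 1 ∷ i ∷ c ∷ []
entryCode (i , c , true)  = 2 ∷ i ∷ c ∷ []

blockCode : Block → List ℕ
blockCode (c , es) = 0 ∷ c ∷ concatMap entryCode es

serialise : List Block → List ℕ
serialise = concatMap blockCode

parse : List ℕ → List Entry × List Block
parse (0 ∷ c ∷ ns)     = [] , (c , proj₁ (parse ns)) ∷ proj₂ (parse ns)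
parse (1 ∷ i ∷ c ∷ ns) = map₁ ((i , c , false) ∷_) (parse ns)
parse (2 ∷ i ∷ c ∷ ns) = map₁ ((i , c , true) ∷_) (parse ns)
parse _                = [] , []

parse-entries : ∀ es ns → parse (concatMap entryCode es ++ ns) ≡ map₁ (es ++_) (parse ns)
parse-entries []                    ns = refl
parse-entries ((i , c , false) ∷ es) ns rewrite parse-entries es ns = refl
parse-entries ((i , c , true)  ∷ es) ns rewrite parse-entries es ns = refl

parse-serialise : ∀ bs → parse (serialise bs) ≡ ([] , bs)
parse-serialise [] = refl
parse-serialise ((c , es) ∷ bs)
  rewrite parse-entries es (serialise bs) | parse-serialise bs | ++-identityʳ es = refl

encodeBlocks : List Block → List Bool
encodeBlocks = unary ∘ serialise

decodeBlocks : List Bool → List Block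
decodeBlocks = proj₂ ∘ parse ∘ ununary

decodeBlocks-encodeBlocks : ∀ bs → decodeBlocks (encodeBlocks bs) ≡ bs
decodeBlocks-encodeBlocks bs rewrite ununary-unary (serialise bs) | parse-serialise bs = refl

EntryWithin : ℕ → Entry → Set
EntryWithin B (i , c , _) = i ≤ B × c ≤ B

BlockWithin : ℕ → ℕ → Block → Set
BlockWithin B E (c , es) = c ≤ B × length es ≤ E × All (EntryWithin B) es

length-entryCode : ∀ e → length (entryCode e) ≡ 3
length-entryCode (_ , _ , false) = refl
length-entryCode (_ , _ , true)  = refl

entryCode-within : ∀ {B} → 2 ≤ B → ∀ {e} → EntryWithin B e → All (_≤ B) (entryCode e)
entryCode-within 2≤B {_ , _ , false} (i≤B , c≤B) = ≤-trans (s≤s z≤n) 2≤B ∷ i≤B ∷ c≤B ∷ []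
entryCode-within 2≤B {_ , _ , true}  (i≤B , c≤B) = 2≤B ∷ i≤B ∷ c≤B ∷ []

serialise-within : ∀ {B E} → 2 ≤ B → ∀ {bs} → All (BlockWithin B E) bs → All (_≤ B) (serialise bs)
serialise-within 2≤B bs-within = All.concat⁺ (All.map⁺ (All.map blockCode-within bs-within))
  where
  blockCode-within : ∀ {b} → BlockWithin _ _ b → All (_≤ _) (blockCode b)
  blockCode-within (c≤B , _ , es-within) =
    z≤n ∷ c≤B ∷ All.concat⁺ (All.map⁺ (All.map (entryCode-within 2≤B) es-within))

length-serialise-≤ : ∀ {B E bs} → All (BlockWithin B E) bs → length (serialise bs) ≤ length bs * (2 + E * 3)
length-serialise-≤ {E = E} = length-concatMap-≤ blockCode ∘ All.map length-blockCode-≤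
  where
  length-blockCode-≤ : ∀ {b} → BlockWithin _ E b → length (blockCode b) ≤ 2 + E * 3
  length-blockCode-≤ {_ , es} (_ , es≤E , _) = s≤s (s≤s (begin
    length (concatMap entryCode es) ≤⟨ length-concatMap-≤ entryCode
                                         (All.universal (≤-reflexive ∘ length-entryCode) es) ⟩
    length es * 3                   ≤⟨ *-monoˡ-≤ 3 es≤E ⟩
    E * 3                           ∎))
    where open ≤-Reasoning

blockSize : ℕ → ℕ → ℕ
blockSize B E = (2 + E * 3) * suc B

length-encodeBlocks-≤ : ∀ {B E} → 2 ≤ B → ∀ {bs} → All (BlockWithin B E) bs →
  length (encodeBlocks bs) ≤ length bs * blockSize B E
length-encodeBlocks-≤ {B} {E} 2≤B {bs} bs-within = begin
  length (unary (serialise bs))           ≤⟨ length-unary-≤ (serialise-within 2≤B bs-within) ⟩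
  length (serialise bs) * suc B           ≤⟨ *-monoˡ-≤ (suc B) (length-serialise-≤ bs-within) ⟩
  length bs * (2 + E * 3) * suc B         ≡⟨ *-assoc (length bs) (2 + E * 3) (suc B) ⟩
  length bs * blockSize B E               ∎
  where open ≤-Reasoning

-- The decoder

resolveEntry : List (List ℕ) → Entry → List ℕ × Bool
resolveEntry parents (i , c , b) = c ∷ lookupOr parents i [] , b

lookupKey : List ℕ → List (List ℕ × Bool) → Maybe Bool
lookupKey key [] = nothing
lookupKey key ((key′ , b) ∷ kbs) with ≡-dec _≟_ key′ key
... | yes _ = just b
... | no  _ = lookupKey key kbs

module _ {A : Set} (f : A → List ℕ) (g : A → Bool) where

  lookupKey-just : ∀ {key b} ys → lookupKey key (map (λ y → f y , g y) ys) ≡ just b →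
    ∃ λ y → y ∈ ys × f y ≡ key × g y ≡ b
  lookupKey-just {key} (y ∷ ys) found with ≡-dec _≟_ (f y) key
  ... | yes fy≡key = y , here refl , fy≡key , just-injective found
  ... | no  _      = let z , z∈ys , fz≡key , gz≡b = lookupKey-just ys found in z , there z∈ys , fz≡key , gz≡b

  lookupKey-nothing : ∀ {key} ys → lookupKey key (map (λ y → f y , g y) ys) ≡ nothing →
    ∀ {y} → y ∈ ys → f y ≢ key
  lookupKey-nothing {key} (y ∷ ys) missing y∈ with ≡-dec _≟_ (f y) key
  lookupKey-nothing (y ∷ ys) () y∈ | yes _
  lookupKey-nothing (y ∷ ys) missing (here refl)  | no fy≢key = fy≢key
  lookupKey-nothing (y ∷ ys) missing (there y∈ys) | no _      = lookupKey-nothing ys missing y∈ys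

-- Blocks are read from the top level down, `cvs` being the block headers of v's label.
-- `parents` are the addresses of the previous block's entries and `vAddress` is v's address
-- so far; the answer is overwritten whenever v's part occurs among the entries, so the
-- lowest such level decides.
decodeFrom : List (List ℕ) → List ℕ → Bool → List Block → List ℕ → Bool
decodeFrom parents vAddress answer ((_ , es) ∷ bs) (cv ∷ cvs) =
  let resolved = map (resolveEntry parents) es
  in decodeFrom (map proj₁ resolved) (cv ∷ vAddress)
                (fromMaybe answer (lookupKey (cv ∷ vAddress) resolved)) bs cvs
decodeFrom _ _ answer _ _ = answer

adjacencyDecoder : List Bool → List Bool → Bool
adjacencyDecoder a b = decodeFrom [] [] false (decodeBlocks a) (map proj₁ (decodeBlocks b))

-- Labels from a merge sequence

module LabelsFromMergeSequence {n} {G : Graph n} {k m} (S : MergeSeq G m)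
  (width : WidthAtMost 1 k S) (valency : ValencyAtMost k S) where

  children : ℕ → ℕ → List ℕ
  children t p = partsMeeting (P S t) (λ y → does (P S (suc t) y ≟ p))

  P-∈-children : ∀ t x → P S t x ∈ children t (P S (suc t) x)
  P-∈-children t x = ∈-partsMeeting (P S t) (dec-true (P S (suc t) x ≟ P S (suc t) x) refl)

  childIndex : ℕ → Fin n → ℕ
  childIndex t x with suc t <? m
  ... | yes _ = firstIndexOn id (P S t x) (children t (P S (suc t) x))
  ... | no  _ = 0

  childIndex-≤ : ∀ t x → childIndex t x ≤ k
  childIndex-≤ t x with suc t <? m
  ... | yes t+1<m = ≤-trans (firstIndexOn-≤ id (P S t x) (children t (P S (suc t) x))) (valency t t+1<m x)
  ... | no  _     = z≤n

  childIndex-cong : ∀ t {x y} → P S t x ≡ P S t y → childIndex t x ≡ childIndex t y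
  childIndex-cong t {x} {y} Pxy with suc t <? m
  ... | yes t+1<m rewrite Pxy | refines S t t+1<m x y Pxy = refl
  ... | no  _     = refl

  childIndex-injective : ∀ t {x y} → suc t < m → P S (suc t) x ≡ P S (suc t) y →
    childIndex t x ≡ childIndex t y → P S t x ≡ P S t y
  childIndex-injective t {x} {y} t+1<m P′xy same-index with suc t <? m
  ... | no t+1≮m = ⊥-elim (t+1≮m t+1<m)
  ... | yes _ rewrite P′xy =
    firstIndexOn-injective id _ (subst (λ p → P S t x ∈ children t p) P′xy (P-∈-children t x))
      (P-∈-children t y) same-index

  childIndices : ℕ → ℕ → Fin n → List ℕ
  childIndices zero    t x = []
  childIndices (suc d) t x = childIndex t x ∷ childIndices d (suc t) x

  childIndices-cong : ∀ d t {x y} → d + t ≤ m → P S t x ≡ P S t y →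
    childIndices d t x ≡ childIndices d t y
  childIndices-cong zero          t _   _   = refl
  childIndices-cong (suc zero)    t _   Pxy = cong (_∷ []) (childIndex-cong t Pxy)
  childIndices-cong (suc (suc d)) t {x} {y} d+t<m Pxy =
    cong₂ _∷_ (childIndex-cong t Pxy)
      (childIndices-cong (suc d) (suc t) (subst (_≤ m) (sym (+-suc (suc d) t)) d+t<m)
        (refines S t (≤-trans (s≤s (s≤s (m≤n+m t d))) d+t<m) x y Pxy))

  childIndices-injective : ∀ d t {x y} → suc d + t ≡ m →
    childIndices (suc d) t x ≡ childIndices (suc d) t y → P S t x ≡ P S t y
  childIndices-injective zero t {x} {y} t+1≡m _ =
    subst (λ s → P S s x ≡ P S s y) (sym (cong (_∸ 1) t+1≡m)) (last-whole S x y)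
  childIndices-injective (suc d) t t+d+2≡m same =
    childIndex-injective t (subst (suc t <_) t+d+2≡m (s≤s (s≤s (m≤n+m t d))))
      (childIndices-injective d (suc t) (trans (+-suc (suc d) t) t+d+2≡m) (∷-injectiveʳ same))
      (∷-injectiveˡ same)

  address : ℕ → Fin n → List ℕ
  address t = childIndices (m ∸ t) t

  address-step : ∀ t x → t < m → address t x ≡ childIndex t x ∷ address (suc t) x
  address-step t x t<m rewrite m>n⇒m∸n≡1+[m∸1+n] t<m = refl

  address-top : ∀ x → address m x ≡ []
  address-top x rewrite n∸n≡0 m = refl

  address-cong : ∀ t {x y} → t ≤ m → P S t x ≡ P S t y → address t x ≡ address t y
  address-cong t t≤m = childIndices-cong (m ∸ t) t (≤-reflexive (m∸n+n≡m t≤m))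

  address-injective : ∀ t {x y} → t < m → address t x ≡ address t y → P S t x ≡ P S t y
  address-injective t t<m rewrite m>n⇒m∸n≡1+[m∸1+n] t<m =
    childIndices-injective (m ∸ suc t) t (trans (sym (+-suc (m ∸ suc t) t)) (m∸n+n≡m t<m))

  module _ (u : Fin n) where

    nearby : ℕ → List (Fin n)
    nearby t with suc t <? m
    ... | yes _ = deduplicateOn (P S t) (members (inBall (R S (suc t)) 1 u))
    ... | no  _ = [ u ]

    length-nearby : ∀ t → length (nearby t) ≤ suc k
    length-nearby t with suc t <? m
    ... | no  _     = s≤s z≤n
    ... | yes t+1<m = m≤n⇒m≤1+n (begin
      length (deduplicateOn (P S t) ball)              ≡⟨ sym (length-map (P S t) (deduplicateOn (P S t) ball)) ⟩
      length (map (P S t) (deduplicateOn (P S t) ball)) ≡⟨ cong length (map-deduplicateOn (P S t) ball) ⟩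
      #partsMeeting (P S t) (inBall (R S (suc t)) 1 u) ≤⟨ width t t+1<m u ⟩
      k                                                ∎)
      where
      open ≤-Reasoning
      ball = members (inBall (R S (suc t)) 1 u)

    nearby-sound : ∀ t {y} → suc t < m → y ∈ nearby t → u ≡ y ⊎ R S (suc t) u y ≡ true
    nearby-sound t t+1<m y∈ with suc t <? m
    ... | no t+1≮m = ⊥-elim (t+1≮m t+1<m)
    ... | yes _    = inBall₁⁻ (R S (suc t))
                       (∈-members⁻ (inBall (R S (suc t)) 1 u) (∈-deduplicateOn⁻ (P S t) _ y∈))

    -- Every vertex of the top level is visible, as P_{m−1} has a single part.
    Visible : ℕ → Fin n → Set
    Visible t x = suc t ≡ m ⊎ u ≡ x ⊎ R S (suc t) u x ≡ true

    nearby-complete : ∀ t {x} → t < m → Visible t x → ∃ λ z → z ∈ nearby t × P S t z ≡ P S t x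
    nearby-complete t {x} t<m visible with suc t <? m | visible
    ... | yes t+1<m | inj₁ refl = ⊥-elim (<-irrefl refl t+1<m)
    ... | yes _     | inj₂ near = deduplicateOn-complete (P S t) (∈-members⁺ (inBall₁⁺ (R S (suc t)) near))
    ... | no t+1≮m  | _         =
      u , here refl ,
      subst (λ s → P S s u ≡ P S s x) (cong (_∸ 1) (≤-antisym (≮⇒≥ t+1≮m) t<m)) (last-whole S u x)

    parentIndex : ℕ → Fin n → ℕ
    parentIndex t y = firstIndexOn (P S (suc t)) (P S (suc t) y) (nearby (suc t))

    parentIndex-≤ : ∀ t y → parentIndex t y ≤ suc k
    parentIndex-≤ t y = ≤-trans (firstIndexOn-≤ (P S (suc t)) _ (nearby (suc t))) (length-nearby (suc t))

    nearby-visible : ∀ t {y} → suc t < m → y ∈ nearby t → Visible (suc t) y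
    nearby-visible t {y} t+1<m y∈ with m≤n⇒m<n∨m≡n t+1<m
    ... | inj₂ t+2≡m = inj₁ t+2≡m
    ... | inj₁ t+2<m = inj₂ (map₂ (R-mono S (suc t) t+2<m u y) (nearby-sound t t+1<m y∈))

    lookupOr-parentIndex : ∀ t {y} → suc t < m → y ∈ nearby t →
      lookupOr (map (address (suc t)) (nearby (suc t))) (parentIndex t y) [] ≡ address (suc t) y
    lookupOr-parentIndex t t+1<m y∈
      with z , z∈ , Pz≡Py ← nearby-complete (suc t) t+1<m (nearby-visible t t+1<m y∈)
      with z′ , _ , Pz′≡Py , lookup≡ ← lookupOr-firstIndexOn (P S (suc t)) (address (suc t)) [] _ z∈ Pz≡Py
      = trans lookup≡ (address-cong (suc t) (<⇒≤ t+1<m) Pz′≡Py)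

    -- At level 0 the parts are singletons, so there the adjacency is exact even for pairs in R_0.
    Determined : ℕ → Fin n → Set
    Determined t v = t ≡ 0 ⊎ R S t u v ≡ false

    adj-cong : ∀ t {v w} → t < m → u ≢ v → u ≢ w → P S t v ≡ P S t w →
      Determined t v → Determined t w → adj G u v ≡ adj G u w
    adj-cong t {v} {w} t<m u≢v u≢w Pvw = λ where
      (inj₁ refl) _           → cong (adj G u) (first-sing S v w Pvw)
      _           (inj₁ refl) → cong (adj G u) (first-sing S v w Pvw)
      (inj₂ Ruv)  (inj₂ Ruw)  → homogeneous S t t<m u v u w u≢v u≢w refl Pvw Ruv Ruw

    HomWitness : ℕ → Fin n → Fin n → Set
    HomWitness t x w = P S t w ≡ P S t x × u ≢ w × Determined t w × adj G u w ≡ true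

    homWitness? : ∀ t x → Decidable (HomWitness t x)
    homWitness? t x w = (P S t w ≟ P S t x) ×-dec ¬? (u Fin.≟ w)
      ×-dec ((t ≟ 0) ⊎-dec (R S t u w Bool.≟ false)) ×-dec (adj G u w Bool.≟ true)

    homBit : ℕ → Fin n → Bool
    homBit t x = does (Fin.any? (homWitness? t x))

    homBit-correct : ∀ t {x v} → t < m → u ≢ v → P S t x ≡ P S t v → Determined t v →
      homBit t x ≡ adj G u v
    homBit-correct t {x} {v} t<m u≢v Pxv det-v with adj G u v in uv-edge
    ... | true  = dec-true (Fin.any? (homWitness? t x)) (v , sym Pxv , u≢v , det-v , uv-edge)
    ... | false = dec-false (Fin.any? (homWitness? t x)) λ (w , Pwx , u≢w , det-w , uw-edge) →
      case trans (sym uw-edge) (trans (adj-cong t t<m u≢w u≢v (trans Pwx Pxv) det-w det-v) uv-edge) of λ ()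

    entry : ℕ → Fin n → Entry
    entry t y = parentIndex t y , childIndex t y , homBit t y

    block : ℕ → Block
    block t = childIndex t u , map (entry t) (nearby t)

    block-within : ∀ t → BlockWithin (2 + k) (suc k) (block t)
    block-within t =
      ≤-trans (childIndex-≤ t u) (m≤n+m k 2) ,
      ≤-trans (≤-reflexive (length-map (entry t) (nearby t))) (length-nearby t) ,
      All.map⁺ (All.universal entry-within (nearby t))
      where
      entry-within : ∀ y → EntryWithin (2 + k) (entry t y)
      entry-within y = m≤n⇒m≤1+n (parentIndex-≤ t y) , ≤-trans (childIndex-≤ t y) (m≤n+m k 2)

    ParentAddresses : ℕ → List (List ℕ) → Set
    ParentAddresses zero    _       = ⊤
    ParentAddresses (suc t) parents =
      ∀ {y} → y ∈ nearby t → lookupOr parents (parentIndex t y) [] ≡ address (suc t) y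

    parentAddresses-top : ∀ {t} → t ≡ m → ParentAddresses t []
    parentAddresses-top {zero}  _      = tt
    parentAddresses-top {suc t} t+1≡m {y} _ =
      sym (subst (λ s → address s y ≡ []) (sym t+1≡m) (address-top y))

    parentAddresses-step : ∀ t → t < m → ParentAddresses t (map (address t) (nearby t))
    parentAddresses-step zero    _   = tt
    parentAddresses-step (suc t) t<m = lookupOr-parentIndex t t<m

    tagged : ℕ → List (List ℕ × Bool)
    tagged t = map (λ y → address t y , homBit t y) (nearby t)

    resolve-entries : ∀ t {parents} → t < m → ParentAddresses (suc t) parents →
      map (resolveEntry parents) (map (entry t) (nearby t)) ≡ tagged t
    resolve-entries t t<m parents-ok =
      trans (sym (map-∘ (nearby t))) (map-cong-local (All.tabulate λ {y} y∈ →
        cong (_, homBit t y) (trans (cong (childIndex t y ∷_) (parents-ok y∈)) (sym (address-step t y t<m)))))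

    module _ {v : Fin n} (u≢v : u ≢ v) where

      Invariant : ℕ → Bool → Set
      Invariant t answer = t < m → Determined t v → answer ≡ adj G u v

      absent⇒invisible : ∀ t → t < m → lookupKey (address t v) (tagged t) ≡ nothing → ¬ Visible t v
      absent⇒invisible t t<m absent visible with z , z∈ , Pz≡Pv ← nearby-complete t t<m visible =
        lookupKey-nothing (address t) (homBit t) (nearby t) absent z∈ (address-cong t (<⇒≤ t<m) Pz≡Pv)

      invariant-step : ∀ t {answer} → t < m → Invariant (suc t) answer →
        Invariant t (fromMaybe answer (lookupKey (address t v) (tagged t)))
      invariant-step t t<m inv _ det-v with lookupKey (address t v) (tagged t) in found
      ... | just b with y , y∈ , address≡ , bit≡b ← lookupKey-just (address t) (homBit t) (nearby t) found =
        trans (sym bit≡b) (homBit-correct t t<m u≢v (address-injective t t<m address≡) det-v)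
      ... | nothing with m≤n⇒m<n∨m≡n t<m
      ...   | inj₂ t+1≡m = ⊥-elim (absent⇒invisible t t<m found (inj₁ t+1≡m))
      ...   | inj₁ t+1<m =
        inv t+1<m (inj₂ (¬-not λ R≡true → absent⇒invisible t t<m found (inj₂ (inj₂ R≡true))))

      decodeFrom-correct : ∀ t {parents answer} → t ≤ m → ParentAddresses t parents → Invariant t answer →
        decodeFrom parents (address t v) answer
                   (map block (downFrom t)) (map (λ s → childIndex s v) (downFrom t)) ≡ adj G u v
      decodeFrom-correct zero    _   _          inv = inv (m-pos S) (inj₁ refl)
      decodeFrom-correct (suc t) {parents} {answer} t<m parents-ok inv = begin
        decodeFrom (map proj₁ resolved) (childIndex t v ∷ address (suc t) v)
          (fromMaybe answer (lookupKey (childIndex t v ∷ address (suc t) v) resolved)) rest vRest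
          ≡⟨ cong₂ (λ rs a → decodeFrom (map proj₁ rs) a (fromMaybe answer (lookupKey a rs)) rest vRest)
                   (resolve-entries t {parents} t<m parents-ok) (sym (address-step t v t<m)) ⟩
        decodeFrom (map proj₁ (tagged t)) (address t v)
          (fromMaybe answer (lookupKey (address t v) (tagged t))) rest vRest
          ≡⟨ cong (λ ps → decodeFrom ps (address t v) answer′ rest vRest) (sym (map-∘ (nearby t))) ⟩
        decodeFrom (map (address t) (nearby t)) (address t v)
          (fromMaybe answer (lookupKey (address t v) (tagged t))) rest vRest
          ≡⟨ decodeFrom-correct t (<⇒≤ t<m) (parentAddresses-step t t<m) (invariant-step t t<m inv) ⟩
        adj G u v ∎
        where
        open ≡-Reasoning
        resolved = map (resolveEntry parents) (map (entry t) (nearby t))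
        answer′ = fromMaybe answer (lookupKey (address t v) (tagged t))
        rest = map block (downFrom t)
        vRest = map (λ s → childIndex s v) (downFrom t)

  label : Fin n → List Bool
  label u = encodeBlocks (map (block u) (downFrom m))

  label-correct : ∀ u v → u ≢ v → adj G u v ≡ adjacencyDecoder (label u) (label v)
  label-correct u v u≢v
    rewrite decodeBlocks-encodeBlocks (map (block u) (downFrom m))
          | decodeBlocks-encodeBlocks (map (block v) (downFrom m))
          | sym (map-∘ {g = proj₁} {f = block v} (downFrom m)) =
    sym (subst (λ a → decodeFrom [] a false blocks-u cs-v ≡ adj G u v) (address-top v)
      (decodeFrom-correct u u≢v m ≤-refl (parentAddresses-top u refl) (λ m<m → ⊥-elim (<-irrefl refl m<m))))
    where
    blocks-u = map (block u) (downFrom m)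
    cs-v = map (λ s → childIndex s v) (downFrom m)

  label-length : ∀ u → length (label u) ≤ m * blockSize (2 + k) (suc k)
  label-length u =
    subst (λ l → length (label u) ≤ l * blockSize (2 + k) (suc k))
      (trans (length-map (block u) (downFrom m)) (length-downFrom m))
      (length-encodeBlocks-≤ (s≤s (s≤s z≤n)) (All.map⁺ (All.universal (block-within u) (downFrom m))))

labelConstant : ℕ → ℕ
labelConstant k = k * blockSize (2 + k) (suc k)

SMW≤⇒labelling : ∀ {n} {G : Graph n} {k} → SMW≤ 1 G k →
  ∃ λ (f : Fin n → List Bool) →
    (∀ u → length (f u) ≤ labelConstant k * ⌈log₂ n ⌉ + labelConstant k) ×
    (∀ u v → u ≢ v → adj G u v ≡ adjacencyDecoder (f u) (f v))
SMW≤⇒labelling {n} {k = k} (m , S , width , valency , length-ok) =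
  label , (λ u → ≤-trans (label-length u) m*B≤) , label-correct
  where
  open LabelsFromMergeSequence S width valency
  B = blockSize (2 + k) (suc k)
  L = ⌈log₂ n ⌉
  m*B≤ : m * B ≤ k * B * L + k * B
  m*B≤ = begin
    m * B              ≤⟨ *-monoˡ-≤ B (LengthOK⇒≤ length-ok) ⟩
    (k + k * L) * B    ≡⟨ solve 3 (λ k L B → (k :+ k :* L) :* B := k :* B :* L :+ k :* B) refl k L B ⟩
    k * B * L + k * B  ∎
    where open ≤-Reasoning

-- Finding a labelling by search

bitStrings≤ : ℕ → List (List Bool)
bitStrings≤ zero    = [ [] ]
bitStrings≤ (suc L) = [] ∷ cartesianProductWith _∷_ (true ∷ false ∷ []) (bitStrings≤ L)

∈-bitStrings≤ : ∀ {L} bs → length bs ≤ L → bs ∈ bitStrings≤ L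
∈-bitStrings≤ {zero}  []       _          = here refl
∈-bitStrings≤ {suc L} []       _          = here refl
∈-bitStrings≤ {suc L} (b ∷ bs) (s≤s bs≤L) =
  there (∈-cartesianProductWith⁺ _∷_ (bit∈ b) (∈-bitStrings≤ bs bs≤L))
  where
  bit∈ : ∀ b → b ∈ true ∷ false ∷ []
  bit∈ true  = here refl
  bit∈ false = there (here refl)

vectorsOver : {A : Set} → List A → (n : ℕ) → List (Vec A n)
vectorsOver xs zero    = [ [] ]
vectorsOver xs (suc n) = cartesianProductWith _∷_ xs (vectorsOver xs n)

∈-vectorsOver : ∀ {A : Set} {xs : List A} {n} (v : Vec A n) → (∀ i → lookup v i ∈ xs) → v ∈ vectorsOver xs n
∈-vectorsOver []      _    = here refl
∈-vectorsOver (a ∷ v) v∈xs =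
  ∈-cartesianProductWith⁺ _∷_ (v∈xs Fin.zero) (∈-vectorsOver v (v∈xs ∘ Fin.suc))

firstSatisfying : {A : Set} {P : A → Set} → Decidable P → A → List A → A
firstSatisfying P? default xs with Any.any? P? xs
... | yes p = proj₁ (satisfied p)
... | no  _ = default

firstSatisfying-satisfies : ∀ {A : Set} {P : A → Set} (P? : Decidable P) default {xs} →
  Any P xs → P (firstSatisfying P? default xs)
firstSatisfying-satisfies P? _ {xs} p with Any.any? P? xs
... | yes q  = proj₂ (satisfied q)
... | no  ¬p = ⊥-elim (¬p p)

module _ (decoder : List Bool → List Bool → Bool) where

  IsLabelling : ∀ {n} → Graph n → ℕ → Vec (List Bool) n → Set
  IsLabelling G L f = (∀ u → length (lookup f u) ≤ L)
                    × (∀ u v → u ≢ v → adj G u v ≡ decoder (lookup f u) (lookup f v))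

  isLabelling? : ∀ {n} (G : Graph n) L → Decidable (IsLabelling G L)
  isLabelling? G L f = Fin.all? (λ u → length (lookup f u) ≤? L)
    ×-dec Fin.all? λ u → Fin.all? λ v →
      ¬? (u Fin.≟ v) →-dec (adj G u v Bool.≟ decoder (lookup f u) (lookup f v))

  searchLabelling : ∀ {n} → Graph n → ℕ → Vec (List Bool) n
  searchLabelling {n} G L =
    firstSatisfying (isLabelling? G L) (Vec.replicate n []) (vectorsOver (bitStrings≤ L) n)

  searchLabelling-correct : ∀ {n} {G : Graph n} {L} (f : Fin n → List Bool) →
    (∀ u → length (f u) ≤ L) → (∀ u v → u ≢ v → adj G u v ≡ decoder (f u) (f v)) →
    IsLabelling G L (searchLabelling G L)
  searchLabelling-correct {G = G} {L} f short correct =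
    firstSatisfying-satisfies (isLabelling? G L) _
      (lose (∈-vectorsOver (tabulate f) λ u → ∈-bitStrings≤ _ (tabulated-short u))
            (tabulated-short , tabulated-correct))
    where
    tabulated-short : ∀ u → length (lookup (tabulate f) u) ≤ L
    tabulated-short u = subst (λ bs → length bs ≤ L) (sym (lookup∘tabulate f u)) (short u)

    tabulated-correct : ∀ u v → u ≢ v → adj G u v ≡ decoder (lookup (tabulate f) u) (lookup (tabulate f) v)
    tabulated-correct u v u≢v = subst₂ (λ a b → adj G u v ≡ decoder a b)
      (sym (lookup∘tabulate f u)) (sym (lookup∘tabulate f v)) (correct u v u≢v)

theorem1p5 : (C : GraphClass) →
    (∃[ k ] (∀ n G → C n G → SMW≤ {n} 1 G k)) →
    HasLogLabelling C
theorem1p5 C (k , smw) =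
  encoder , adjacencyDecoder , (λ n G G∈C → proj₂ (found n G G∈C)) ,
  labelConstant k , (λ n G G∈C → proj₁ (found n G G∈C))
  where
  bound : ℕ → ℕ
  bound n = labelConstant k * ⌈log₂ n ⌉ + labelConstant k

  encoder : (n : ℕ) → Graph n → Fin n → List Bool
  encoder n G = lookup (searchLabelling adjacencyDecoder G (bound n))

  found : ∀ n G → C n G → IsLabelling adjacencyDecoder G (bound n) (searchLabelling adjacencyDecoder G (bound n))
  found n G G∈C with f , f-short , f-correct ← SMW≤⇒labelling (smw n G G∈C) =
    searchLabelling-correct adjacencyDecoder {G = G} {bound n} f f-short f-correct
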